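{- Let $b\ge 3$ be an odd integer and $n$ an even positive integer. Let $K(i,j)$, for $i,j\in\{ -\tfrac n2,\dots,\tfrac n2\}$, be the transition probability of the balanced carries Markov chain (defined in the context). Then $K(i,j)$ is equal to both: (1) the coefficient of $x^{jb+(n+1)(b-1)/2-i}$ in $(1+x+\cdots+x^{b-1})^{n+1}/b^n$; (2) $\displaystyle \frac{1}{b^n}\sum_{l=0}^{\lfloor j+\frac{n+1}{b}\frac{b-1}{2}-\frac{i}{b}\rfloor}(-1)^l\binom{n+1}{l}\binom{n+jb+(n+1)\frac{b-1}{2}-i-lb}{n}$.
   Context: Balanced digits base $b$ ($b$ odd) are the integers $-\tfrac{b-1}{2},\dots,0,\dots,\tfrac{b-1}{2}$. When $n$ numbers written in balanced digits are added column by column from right to left, if the carry into a column is $i$ and the digits in that column are $X_1,\dots,X_n$, the carry out of the column is the unique integer $j$ with $jb-\tfrac{b-1}{2}\le i+X_1+\cdots+X_n\le jb+\tfrac{b-1}{2}$. The first carry is $0$. When all digits are chosen independently and uniformly from the balanced digit set, the successive carries form a Markov chain, the balanced carries chain; for $n$ even its state space is $\{ -\tfrac n2,\dots,\tfrac n2\}$, and $K(i,j)$ denotes the probability that the carry out is $j$ given the carry in is $i$. -}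

module Defs where

open import Data.Nat as ℕ using (ℕ; zero; suc; _∸_; _^_)
open import Data.Nat.Combinatorics using (_C_)
open import Data.Nat.Properties using (m^n≢0)
open import Data.Integer as ℤ using (ℤ; +_; -[1+_]; _+_; _-_; _*_; _≤_; _≤?_)
open import Data.Integer.Base using (_/ℕ_)
open import Data.List using (List; []; _∷_; map; concatMap; upTo; filter; length; foldr)
open import Data.Product using (_×_)
open import Relation.Nullary.Decidable using (_×-dec_)
open import Data.Rational using (ℚ; 0ℚ)
import Data.Rational as ℚ

sum : List ℤ → ℤ
sum = foldr _+_ (+ 0)

half : ℕ → ℕ
half b = (b ∸ 1) ℕ./ 2

balancedDigits : ℕ → List ℤ
balancedDigits b = map (λ k → + k - + half b) (upTo b)

-- all n-tuples of balanced digits (each tuple equally likely: b^n of them)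
tuples : ℕ → ℕ → List (List ℤ)
tuples b zero    = [] ∷ []
tuples b (suc n) = concatMap (λ d → map (d ∷_) (tuples b n)) (balancedDigits b)

CarryOut : ℕ → ℤ → List ℤ → ℤ → Set
CarryOut b i xs j =
  (j * + b - + half b ≤ i + sum xs) × (i + sum xs ≤ j * + b + + half b)

carryOut? : ∀ b i xs j → Relation.Nullary.Decidable.Dec (CarryOut b i xs j)
carryOut? b i xs j =
  (j * + b - + half b ≤? i + sum xs) ×-dec (i + sum xs ≤? j * + b + + half b)

carryCount : ℕ → ℕ → ℤ → ℤ → ℕ
carryCount b n i j = length (filter (λ xs → carryOut? b i xs j) (tuples b n))

-- x / b^n as a rational (b = 0 is excluded by the theorem's hypotheses)
_over_^_ : ℤ → ℕ → ℕ → ℚ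
x over zero  ^ n = 0ℚ
x over suc c ^ n = ℚ._/_ x (suc c ^ n) {{m^n≢0 (suc c) n}}

K : ℕ → ℕ → ℤ → ℤ → ℚ
K b n i j = (+ carryCount b n i j) over b ^ n

-- Polynomials with natural coefficients as coefficient lists (constant term first)
Poly : Set
Poly = List ℕ

_⊕_ : Poly → Poly → Poly
[]       ⊕ q        = q
p        ⊕ []       = p
(a ∷ p) ⊕ (c ∷ q) = (a ℕ.+ c) ∷ (p ⊕ q)

_⊛_ : Poly → Poly → Poly
[]      ⊛ q = []
(a ∷ p) ⊛ q = map (a ℕ.*_) q ⊕ (0 ∷ (p ⊛ q))

polyPow : Poly → ℕ → Poly
polyPow p zero    = 1 ∷ []
polyPow p (suc k) = p ⊛ polyPow p k

geomPoly : ℕ → Poly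
geomPoly b = map (λ _ → 1) (upTo b)

coeffℕ : Poly → ℕ → ℕ
coeffℕ []      _       = 0
coeffℕ (a ∷ p) zero    = a
coeffℕ (a ∷ p) (suc k) = coeffℕ p k

coeff : Poly → ℤ → ℕ
coeff p (+ k)     = coeffℕ p k
coeff p -[1+ _ ] = 0

expo : ℕ → ℕ → ℤ → ℤ → ℤ
expo b n i j = j * + b + + (suc n ℕ.* half b) - i

-- binomial coefficient with an integer top entry (0 for negative top;
-- in the theorem's sum the top entry is always ≥ n ≥ 0)
choose : ℤ → ℕ → ℕ
choose (+ m)     k = m C k
choose -[1+ _ ] k = 0

signPow : ℕ → ℤ
signPow zero    = + 1
signPow (suc l) = ℤ.- signPow l

sumTo : ℤ → (ℕ → ℤ) → ℤ
sumTo (+ u)     f = sum (map f (upTo (suc u)))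
sumTo -[1+ _ ] f = + 0

-- floor division of an integer by b (b = 0 excluded by hypotheses)
floorDiv : ℤ → ℕ → ℤ
floorDiv x zero    = + 0
floorDiv x (suc c) = x /ℕ suc c

alternatingSum : ℕ → ℕ → ℤ → ℤ → ℤ
alternatingSum b n i j =
  sumTo (floorDiv (expo b n i j) b)
        (λ l → signPow l * + ((suc n) C l)
                 * + choose (+ n + expo b n i j - + (l ℕ.* b)) n)

-- Writing b = 2h + 1, the carry out of a column is j exactly when the digit sum lies in the
-- window (T - b, T] with T = jb + h - i. Shifting every digit by h, the number of digit
-- n-tuples with sum s is the coefficient of x^(s + nh) in G^n, G = 1 + x + ⋯ + x^(b-1), and a
-- sum of b consecutive coefficients of a polynomial is a coefficient of its product with G;
-- this gives (1).
-- For (2), let ∇ₛ f(y) = f(y) - f(y - s) and B_N(y) = C(N + y, N). Pascal's rule reads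
-- ∇₁ B_(N+1) = B_N, ∇₁ B_0 is the coefficient function of 1, and a sum of b consecutive values
-- of ∇₁ g telescopes to ∇_b g. By induction the coefficient of x^y in G^(N+1) is ∇_b^(N+1) B_N(y),
-- which the binomial theorem expands into Σ_l (-1)^l C(N+1, l) B_N(y - lb); the terms with
-- lb > y vanish, which gives the upper limit of summation.
module Submission where

open import Defs
open import Data.Nat as ℕ using (ℕ; zero; suc; _≤_; _<_; z≤n; s≤s)
import Data.Nat.Properties as ℕP
import Data.Nat.DivMod as ℕD
open import Data.Nat.Divisibility using (_∣_; divides)
open import Data.Nat.Combinatorics using (_C_; k>n⇒nCk≡0; nCk+nC[k+1]≡[n+1]C[k+1])
open import Data.Nat.ListAction using () renaming (sum to sumℕ)
import Data.Nat.Tactic.RingSolver as ℕ-Solver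
open import Data.Integer as ℤ using (ℤ; +_; -_; -[1+_]; _+_; _-_; _*_)
import Data.Integer.Properties as ℤP
import Data.Integer.DivMod as ℤD
open import Data.Integer.Tactic.RingSolver using (solve-∀)
open import Data.List using (List; []; _∷_; _++_; map; upTo; applyUpTo; length; filter; concatMap)
import Data.List.Properties as LP
open import Data.Product using (_×_; _,_; proj₁; proj₂)
open import Data.Sum using (_⊎_; inj₁; inj₂)
open import Function using (_∘_)
open import Level using (0ℓ)
open import Relation.Binary.PropositionalEquality
  using (_≡_; refl; sym; trans; cong; cong₂; subst; module ≡-Reasoning)
open import Relation.Nullary using (¬_; yes; no; contradiction)
open import Relation.Nullary.Decidable using (_×-dec_)
open import Relation.Unary using (Pred; Decidable; Empty; _≐_; _∪_; _∩_)
open ≡-Reasoning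

-- Finite sums and differences

∑ : ℕ → (ℕ → ℤ) → ℤ
∑ zero    f = + 0
∑ (suc U) f = f 0 + ∑ U (f ∘ suc)

∑-cong : ∀ U {f g : ℕ → ℤ} → (∀ l → f l ≡ g l) → ∑ U f ≡ ∑ U g
∑-cong zero    f≗g = refl
∑-cong (suc U) f≗g = cong₂ _+_ (f≗g 0) (∑-cong U (f≗g ∘ suc))

∑-zero : ∀ U {f : ℕ → ℤ} → (∀ l → f l ≡ + 0) → ∑ U f ≡ + 0
∑-zero zero    f≗0 = refl
∑-zero (suc U) f≗0 = cong₂ _+_ (f≗0 0) (∑-zero U (f≗0 ∘ suc))

∑-pad : ∀ U k {f : ℕ → ℤ} → (∀ l → U ≤ l → f l ≡ + 0) → ∑ U f ≡ ∑ (U ℕ.+ k) f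
∑-pad zero    k     f≗0 = sym (∑-zero k (λ l → f≗0 l z≤n))
∑-pad (suc U) k {f} f≗0 = cong (λ t → f 0 + t) (∑-pad U k (λ l → f≗0 (suc l) ∘ s≤s))

∑-sub : ∀ U (f g : ℕ → ℤ) → ∑ U (λ l → f l - g l) ≡ ∑ U f - ∑ U g
∑-sub zero    f g = refl
∑-sub (suc U) f g = begin
  (f 0 - g 0) + ∑ U (λ l → f (suc l) - g (suc l)) ≡⟨ cong (λ t → (f 0 - g 0) + t) (∑-sub U (f ∘ suc) (g ∘ suc)) ⟩
  (f 0 - g 0) + (∑ U (f ∘ suc) - ∑ U (g ∘ suc))   ≡⟨ interchange (f 0) (g 0) _ _ ⟩
  (f 0 + ∑ U (f ∘ suc)) - (g 0 + ∑ U (g ∘ suc))   ∎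
  where
  interchange : ∀ a b c d → (a - b) + (c - d) ≡ (a + c) - (b + d)
  interchange = solve-∀

sum-map-upTo : ∀ (f : ℕ → ℤ) U → sum (map f (upTo U)) ≡ ∑ U f
sum-map-upTo f U = trans (cong sum (LP.map-upTo f U)) (sum-applyUpTo f U)
  where
  sum-applyUpTo : ∀ (f : ℕ → ℤ) U → sum (applyUpTo f U) ≡ ∑ U f
  sum-applyUpTo f zero    = refl
  sum-applyUpTo f (suc U) = cong (λ t → f 0 + t) (sum-applyUpTo (f ∘ suc) U)

∇ : ℕ → (ℤ → ℤ) → ℤ → ℤ
∇ s f x = f x - f (x - + s)

∇^ : ℕ → ℕ → (ℤ → ℤ) → ℤ → ℤ
∇^ s zero    f = f
∇^ s (suc r) f = ∇ s (∇^ s r f)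

∇^-cong : ∀ s r {f g : ℤ → ℤ} → (∀ y → f y ≡ g y) → ∀ x → ∇^ s r f x ≡ ∇^ s r g x
∇^-cong s zero    f≗g x = f≗g x
∇^-cong s (suc r) f≗g x = cong₂ _-_ (∇^-cong s r f≗g x) (∇^-cong s r f≗g (x - + s))

∇-comm : ∀ s t f x → ∇ s (∇ t f) x ≡ ∇ t (∇ s f) x
∇-comm s t f x = begin
  (f x - f (x - + t)) - (f (x - + s) - f ((x - + s) - + t))
    ≡⟨ cong (λ y → (f x - f (x - + t)) - (f (x - + s) - f y)) (swap x (+ s) (+ t)) ⟩
  (f x - f (x - + t)) - (f (x - + s) - f ((x - + t) - + s))
    ≡⟨ middle (f x) _ _ _ ⟩
  (f x - f (x - + s)) - (f (x - + t) - f ((x - + t) - + s)) ∎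
  where
  swap : ∀ x s t → (x - s) - t ≡ (x - t) - s
  swap = solve-∀
  middle : ∀ a b c d → (a - b) - (c - d) ≡ (a - c) - (b - d)
  middle = solve-∀

∇^-∇ : ∀ s r t f x → ∇^ s r (∇ t f) x ≡ ∇ t (∇^ s r f) x
∇^-∇ s zero    t f x = refl
∇^-∇ s (suc r) t f x = begin
  ∇ s (∇^ s r (∇ t f)) x ≡⟨ cong₂ _-_ (∇^-∇ s r t f x) (∇^-∇ s r t f (x - + s)) ⟩
  ∇ s (∇ t (∇^ s r f)) x ≡⟨ ∇-comm s t (∇^ s r f) x ⟩
  ∇ t (∇ s (∇^ s r f)) x ∎

altBinomSum : ℕ → ℕ → (ℕ → ℤ) → ℤ
altBinomSum r U F = ∑ U (λ l → signPow l * + (r C l) * F l)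

altBinomSum-pascal : ∀ r U F →
  altBinomSum (suc r) (suc U) F ≡ altBinomSum r (suc U) F - altBinomSum r U (F ∘ suc)
altBinomSum-pascal r U F = begin
  + 1 * + 1 * F 0 + ∑ U (λ l → - σ l * + (suc r C suc l) * F (suc l))
    ≡⟨ cong (λ t → + 1 * + 1 * F 0 + t) (∑-cong U (λ l → trans
         (cong (λ c → - σ l * + c * F (suc l)) (sym (nCk+nC[k+1]≡[n+1]C[k+1] r l)))
         (split (σ l) (+ (r C l)) (+ (r C suc l)) (F (suc l))))) ⟩
  + 1 * + 1 * F 0 + ∑ U (λ l → - σ l * + (r C suc l) * F (suc l) - σ l * + (r C l) * F (suc l))
    ≡⟨ cong (λ t → + 1 * + 1 * F 0 + t) (∑-sub U _ _) ⟩
  + 1 * + 1 * F 0 + (∑ U (λ l → - σ l * + (r C suc l) * F (suc l)) - altBinomSum r U (F ∘ suc))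
    ≡⟨ ℤP.+-assoc (+ 1 * + 1 * F 0) _ _ ⟨
  altBinomSum r (suc U) F - altBinomSum r U (F ∘ suc) ∎
  where
  σ = signPow
  split : ∀ s a c f → (- s) * (a + c) * f ≡ (- s) * c * f - s * a * f
  split = solve-∀

∇^-altBinomSum : ∀ s r U g x → r < U → ∇^ s r g x ≡ altBinomSum r U (λ l → g (x - + (l ℕ.* s)))
∇^-altBinomSum s zero (suc U) g x _ = sym (begin
  + 1 * + 1 * g (x - + 0) + ∑ U (λ l → signPow (suc l) * + 0 * g (x - + (suc l ℕ.* s)))
    ≡⟨ cong₂ (λ a t → + 1 * + 1 * g a + t) (ℤP.+-identityʳ x)
             (∑-zero U (λ l → zeroMid (signPow (suc l)) (g (x - + (suc l ℕ.* s))))) ⟩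
  + 1 * + 1 * g x + + 0
    ≡⟨ unit (g x) ⟩
  g x ∎)
  where
  zeroMid : ∀ s a → s * + 0 * a ≡ + 0
  zeroMid = solve-∀
  unit : ∀ a → + 1 * + 1 * a + + 0 ≡ a
  unit = solve-∀
∇^-altBinomSum s (suc r) (suc U) g x (s≤s r<U) = begin
  ∇^ s r g x - ∇^ s r g (x - + s)
    ≡⟨ cong₂ _-_ (∇^-altBinomSum s r (suc U) g x (ℕP.m<n⇒m<1+n r<U))
                 (∇^-altBinomSum s r U g (x - + s) r<U) ⟩
  altBinomSum r (suc U) F - altBinomSum r U (λ l → g ((x - + s) - + (l ℕ.* s)))
    ≡⟨ cong (λ t → altBinomSum r (suc U) F - t)
            (∑-cong U (λ l → cong (λ y → signPow l * + (r C l) * g y) (assoc x (+ s) (+ (l ℕ.* s))))) ⟩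
  altBinomSum r (suc U) F - altBinomSum r U (F ∘ suc)
    ≡⟨ altBinomSum-pascal r U F ⟨
  altBinomSum (suc r) (suc U) F ∎
  where
  F = λ l → g (x - + (l ℕ.* s))
  assoc : ∀ x s t → (x - s) - t ≡ x - (s + t)
  assoc = solve-∀

window : (ℤ → ℕ) → ℕ → ℤ → ℕ
window f zero    x = 0
window f (suc k) x = f x ℕ.+ window f k (x - + 1)

window-∇ : ∀ (g : ℤ → ℤ) {f : ℤ → ℕ} → (∀ y → + f y ≡ ∇ 1 g y) → ∀ k x → + window f k x ≡ ∇ k g x
window-∇ g     f≡∇g zero    x =
  sym (trans (cong (λ y → g x - g y) (ℤP.+-identityʳ x)) (ℤP.+-inverseʳ (g x)))
window-∇ g {f} f≡∇g (suc k) x = begin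
  + f x + + window f k (x - + 1)
    ≡⟨ cong₂ _+_ (f≡∇g x) (window-∇ g f≡∇g k (x - + 1)) ⟩
  (g x - g (x - + 1)) + (g (x - + 1) - g ((x - + 1) - + k))
    ≡⟨ cong (λ y → (g x - g (x - + 1)) + (g (x - + 1) - g y)) (assoc x (+ k)) ⟩
  (g x - g (x - + 1)) + (g (x - + 1) - g (x - + suc k))
    ≡⟨ telescope (g x) _ _ ⟩
  g x - g (x - + suc k) ∎
  where
  assoc : ∀ x k → (x - + 1) - k ≡ x - (+ 1 + k)
  assoc = solve-∀
  telescope : ∀ a b c → (a - b) + (b - c) ≡ a - c
  telescope = solve-∀

window-shift : ∀ {f g : ℤ → ℕ} a → (∀ s → g s ≡ f (s + a)) → ∀ k x → window g k x ≡ window f k (x + a)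
window-shift a g≗f zero    x = refl
window-shift a g≗f (suc k) x =
  cong₂ ℕ._+_ (g≗f x) (trans (window-shift a g≗f k (x - + 1)) (cong (window _ k) (comm x a)))
  where
  comm : ∀ x a → (x - + 1) + a ≡ (x + a) - + 1
  comm = solve-∀

sumℕ-map-upTo : ∀ (f : ℤ → ℕ) g k x → (∀ m → g m ≡ f (x - + m)) → sumℕ (map g (upTo k)) ≡ window f k x
sumℕ-map-upTo f g k x g≗f = trans (cong sumℕ (LP.map-upTo g k)) (sum-applyUpTo g k x g≗f)
  where
  sum-applyUpTo : ∀ g k x → (∀ m → g m ≡ f (x - + m)) → sumℕ (applyUpTo g k) ≡ window f k x
  sum-applyUpTo g zero    x g≗f = refl
  sum-applyUpTo g (suc k) x g≗f =
    cong₂ ℕ._+_ (trans (g≗f 0) (cong f (ℤP.+-identityʳ x)))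
                (sum-applyUpTo (g ∘ suc) k (x - + 1) (λ m → trans (g≗f (suc m)) (cong f (assoc x (+ m)))))
    where
    assoc : ∀ x m → x - (+ 1 + m) ≡ (x - + 1) - m
    assoc = solve-∀

-- C(N + y, N) is the coefficient of x^y in (1 - x)^-(N+1).
binom : ℕ → ℤ → ℤ
binom N y = + choose (+ N + y) N

binom-negative : ∀ N y → y ℤ.< + 0 → binom N y ≡ + 0
binom-negative N (+ _)     (ℤ.+<+ ())
binom-negative N -[1+ t ] _ = cong +_ (choose-below (+ N + -[1+ t ]) below)
  where
  choose-below : ∀ z → z ℤ.< + N → choose z N ≡ 0
  choose-below (+ m)     (ℤ.+<+ m<N) = k>n⇒nCk≡0 m<N
  choose-below -[1+ _ ] _           = refl
  below : + N + -[1+ t ] ℤ.< + N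
  below = subst (+ N + -[1+ t ] ℤ.<_) (ℤP.+-identityʳ (+ N)) (ℤP.+-monoʳ-< (+ N) ℤ.-<+)

∇1-binom : ∀ N y → ∇ 1 (binom (suc N)) y ≡ binom N y
∇1-binom N (+ t) = begin
  + (suc (N ℕ.+ t) C suc N) - + choose (+ suc N + (+ t - + 1)) (suc N)
    ≡⟨ cong₂ (λ c y → + c - + choose y (suc N))
             (sym (nCk+nC[k+1]≡[n+1]C[k+1] (N ℕ.+ t) N)) (shift (+ N) (+ t)) ⟩
  + ((N ℕ.+ t) C N ℕ.+ (N ℕ.+ t) C suc N) - + ((N ℕ.+ t) C suc N)
    ≡⟨ cancel (+ ((N ℕ.+ t) C N)) (+ ((N ℕ.+ t) C suc N)) ⟩
  + ((N ℕ.+ t) C N) ∎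
  where
  shift : ∀ a b → + 1 + a + (b - + 1) ≡ a + b
  shift = solve-∀
  cancel : ∀ a b → (a + b) - b ≡ a
  cancel = solve-∀
∇1-binom N -[1+ t ] = begin
  binom (suc N) -[1+ t ] - binom (suc N) (-[1+ t ] - + 1)
    ≡⟨ cong₂ _-_ (binom-negative (suc N) -[1+ t ] ℤ.-<+) (binom-negative (suc N) (-[1+ t ] - + 1) ℤ.-<+) ⟩
  + 0
    ≡⟨ binom-negative N _ ℤ.-<+ ⟨
  binom N -[1+ t ] ∎

∇1-binom0 : ∀ y → ∇ 1 (binom 0) y ≡ + coeff (1 ∷ []) y
∇1-binom0 (+ zero)  = refl
∇1-binom0 (+ suc t) = refl
∇1-binom0 -[1+ t ]  = refl

-- Coefficients of powers of 1 + x + ⋯ + x^(b-1)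

coeff-⊕ : ∀ p q x → coeff (p ⊕ q) x ≡ coeff p x ℕ.+ coeff q x
coeff-⊕ p       q       -[1+ _ ]  = refl
coeff-⊕ []      q       (+ k)     = refl
coeff-⊕ (a ∷ p) []      (+ k)     = sym (ℕP.+-identityʳ _)
coeff-⊕ (a ∷ p) (c ∷ q) (+ zero)  = refl
coeff-⊕ (a ∷ p) (c ∷ q) (+ suc k) = coeff-⊕ p q (+ k)

coeff-scale : ∀ a q x → coeff (map (a ℕ.*_) q) x ≡ a ℕ.* coeff q x
coeff-scale a q       -[1+ _ ]  = sym (ℕP.*-zeroʳ a)
coeff-scale a []      (+ k)     = sym (ℕP.*-zeroʳ a)
coeff-scale a (c ∷ q) (+ zero)  = refl
coeff-scale a (c ∷ q) (+ suc k) = coeff-scale a q (+ k)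

coeff-shift : ∀ p x → coeff (0 ∷ p) x ≡ coeff p (x - + 1)
coeff-shift p (+ zero)  = refl
coeff-shift p (+ suc k) = refl
coeff-shift p -[1+ _ ]  = refl

coeff-ones-⊛ : ∀ {A : Set} (xs : List A) q x →
               coeff (map (λ _ → 1) xs ⊛ q) x ≡ window (coeff q) (length xs) x
coeff-ones-⊛ []       q (+ _)     = refl
coeff-ones-⊛ []       q -[1+ _ ] = refl
coeff-ones-⊛ (_ ∷ xs) q x = begin
  coeff (map (1 ℕ.*_) q ⊕ (0 ∷ (map (λ _ → 1) xs ⊛ q))) x
    ≡⟨ coeff-⊕ (map (1 ℕ.*_) q) _ x ⟩
  coeff (map (1 ℕ.*_) q) x ℕ.+ coeff (0 ∷ (map (λ _ → 1) xs ⊛ q)) x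
    ≡⟨ cong₂ ℕ._+_ (trans (coeff-scale 1 q x) (ℕP.*-identityˡ _))
                   (trans (coeff-shift _ x) (coeff-ones-⊛ xs q (x - + 1))) ⟩
  coeff q x ℕ.+ window (coeff q) (length xs) (x - + 1) ∎

coeff-geomPoly-⊛ : ∀ b q x → coeff (geomPoly b ⊛ q) x ≡ window (coeff q) b x
coeff-geomPoly-⊛ b q x =
  trans (coeff-ones-⊛ (upTo b) q x) (cong (λ k → window (coeff q) k x) (LP.length-upTo b))

coeff-geomPoly^suc : ∀ b N x → + coeff (polyPow (geomPoly b) (suc N)) x ≡ ∇^ b (suc N) (binom N) x
coeff-geomPoly^suc b zero    x =
  trans (cong +_ (coeff-geomPoly-⊛ b _ x)) (window-∇ (binom 0) (sym ∘ ∇1-binom0) b x)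
coeff-geomPoly^suc b (suc N) x =
  trans (cong +_ (coeff-geomPoly-⊛ b _ x)) (window-∇ (∇^ b (suc N) (binom (suc N))) coeff≡∇1 b x)
  where
  coeff≡∇1 : ∀ y → + coeff (polyPow (geomPoly b) (suc N)) y ≡ ∇ 1 (∇^ b (suc N) (binom (suc N))) y
  coeff≡∇1 y = begin
    + coeff (polyPow (geomPoly b) (suc N)) y   ≡⟨ coeff-geomPoly^suc b N y ⟩
    ∇^ b (suc N) (binom N) y                   ≡⟨ ∇^-cong b (suc N) (sym ∘ ∇1-binom N) y ⟩
    ∇^ b (suc N) (∇ 1 (binom (suc N))) y       ≡⟨ ∇^-∇ b (suc N) 1 (binom (suc N)) y ⟩
    ∇ 1 (∇^ b (suc N) (binom (suc N))) y       ∎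

sumTo-floorDiv-negative : ∀ c t (f : ℕ → ℤ) → sumTo (floorDiv -[1+ t ] (suc c)) f ≡ + 0
sumTo-floorDiv-negative c t f with -[1+ t ] ℤ./ℕ suc c | ℤD.[n/ℕd]*d≤n -[1+ t ] (suc c)
... | -[1+ _ ] | _       = refl
... | + u      | q*b≤x with subst (ℤ._≤ -[1+ t ]) (sym (ℤP.pos-* u (suc c))) q*b≤x
...   | ()

coeff-geomPoly^suc-alternating : ∀ c n x →
  + coeff (polyPow (geomPoly (suc c)) (suc n)) x ≡
  sumTo (floorDiv x (suc c)) (λ l → signPow l * + (suc n C l) * + choose (+ n + x - + (l ℕ.* suc c)) n)
coeff-geomPoly^suc-alternating c n -[1+ t ] = sym (sumTo-floorDiv-negative c t _)
coeff-geomPoly^suc-alternating c n (+ t) = sym (begin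
  sum (map T (upTo (suc u)))
    ≡⟨ sum-map-upTo T (suc u) ⟩
  ∑ (suc u) T
    ≡⟨ ∑-cong (suc u) (λ l → cong (λ y → signPow l * + (suc n C l) * + choose y n)
                                  (ℤP.+-assoc (+ n) (+ t) (- + (l ℕ.* b)))) ⟩
  altBinomSum (suc n) (suc u) F
    ≡⟨ ∑-pad (suc u) (suc n) (λ l u<l → trans (cong (signPow l * + (suc n C l) *_) (F-vanishes l u<l))
                                              (ℤP.*-zeroʳ (signPow l * + (suc n C l)))) ⟩
  altBinomSum (suc n) (suc u ℕ.+ suc n) F
    ≡⟨ ∇^-altBinomSum b (suc n) (suc u ℕ.+ suc n) (binom n) (+ t) (s≤s (ℕP.m≤n+m (suc n) u)) ⟨
  ∇^ b (suc n) (binom n) (+ t)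
    ≡⟨ coeff-geomPoly^suc b n (+ t) ⟨
  + coeff (polyPow (geomPoly b) (suc n)) (+ t) ∎)
  where
  b = suc c
  u = t ℕ./ b
  T = λ l → signPow l * + (suc n C l) * + choose (+ n + + t - + (l ℕ.* b)) n
  F = λ l → binom n (+ t - + (l ℕ.* b))
  F-vanishes : ∀ l → suc u ≤ l → F l ≡ + 0
  F-vanishes l u<l = binom-negative n _ (subst (+ t - + (l ℕ.* b) ℤ.<_) (ℤP.+-inverseʳ (+ (l ℕ.* b)))
                                               (ℤP.+-monoˡ-< (- + (l ℕ.* b)) (ℤ.+<+ t<lb)))
    where
    t<lb : t < l ℕ.* b
    t<lb = ℕP.≰⇒> (λ lb≤t → ℕP.<⇒≱ u<l (subst (_≤ u) (ℕD.m*n/n≡m l b) (ℕD./-monoˡ-≤ b lb≤t)))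

-- Counting digit tuples

count : {A : Set} {P : Pred A 0ℓ} → Decidable P → List A → ℕ
count P? xs = length (filter P? xs)

module _ {A : Set} where

  count-≐ : {P Q : Pred A 0ℓ} (P? : Decidable P) (Q? : Decidable Q) → P ≐ Q →
            ∀ xs → count P? xs ≡ count Q? xs
  count-≐ P? Q? P≐Q xs = cong length (LP.filter-≐ P? Q? P≐Q xs)

  count-∅ : {P : Pred A 0ℓ} (P? : Decidable P) → Empty P → ∀ xs → count P? xs ≡ 0
  count-∅ P? ∅P []       = refl
  count-∅ P? ∅P (x ∷ xs) with P? x
  ... | yes p = contradiction p (∅P x)
  ... | no  _ = count-∅ P? ∅P xs

  count-∪ : {P Q R : Pred A 0ℓ} (P? : Decidable P) (Q? : Decidable Q) (R? : Decidable R) →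
            Empty (Q ∩ R) → P ≐ Q ∪ R → ∀ xs → count P? xs ≡ count Q? xs ℕ.+ count R? xs
  count-∪ P? Q? R? Q∩R≡∅ P≐Q∪R [] = refl
  count-∪ P? Q? R? Q∩R≡∅ P≐Q∪R (x ∷ xs) with P? x | Q? x | R? x
  ... | yes _ | yes q | yes r = contradiction (q , r) (Q∩R≡∅ x)
  ... | yes _ | yes _ | no  _ = cong suc (count-∪ P? Q? R? Q∩R≡∅ P≐Q∪R xs)
  ... | yes _ | no  _ | yes _ = trans (cong suc (count-∪ P? Q? R? Q∩R≡∅ P≐Q∪R xs)) (sym (ℕP.+-suc _ _))
  ... | yes p | no ¬q | no ¬r with proj₁ P≐Q∪R p
  ...   | inj₁ q = contradiction q ¬q
  ...   | inj₂ r = contradiction r ¬r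
  count-∪ P? Q? R? Q∩R≡∅ P≐Q∪R (x ∷ xs) | no ¬p | yes q | _     = contradiction (proj₂ P≐Q∪R (inj₁ q)) ¬p
  count-∪ P? Q? R? Q∩R≡∅ P≐Q∪R (x ∷ xs) | no ¬p | no _  | yes r = contradiction (proj₂ P≐Q∪R (inj₂ r)) ¬p
  count-∪ P? Q? R? Q∩R≡∅ P≐Q∪R (x ∷ xs) | no _  | no _  | no _  = count-∪ P? Q? R? Q∩R≡∅ P≐Q∪R xs

  count-map : ∀ {B : Set} {P : Pred B 0ℓ} (P? : Decidable P) (f : A → B) xs →
              count P? (map f xs) ≡ count (P? ∘ f) xs
  count-map P? f []       = refl
  count-map P? f (x ∷ xs) with P? (f x)
  ... | yes _ = cong suc (count-map P? f xs)
  ... | no  _ = count-map P? f xs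

  count-concatMap : ∀ {B : Set} {P : Pred B 0ℓ} (P? : Decidable P) (f : A → List B) xs →
                    count P? (concatMap f xs) ≡ sumℕ (map (count P? ∘ f) xs)
  count-concatMap P? f []       = refl
  count-concatMap P? f (x ∷ xs) = begin
    length (filter P? (f x ++ concatMap f xs))             ≡⟨ cong length (LP.filter-++ P? (f x) (concatMap f xs)) ⟩
    length (filter P? (f x) ++ filter P? (concatMap f xs)) ≡⟨ LP.length-++ (filter P? (f x)) ⟩
    count P? (f x) ℕ.+ count P? (concatMap f xs)           ≡⟨ cong (count P? (f x) ℕ.+_) (count-concatMap P? f xs) ⟩
    count P? (f x) ℕ.+ sumℕ (map (count P? ∘ f) xs)        ∎

InWindow : ℤ → ℕ → ℤ → Set
InWindow top k s = top - + k ℤ.< s × s ℤ.≤ top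

inWindow? : ∀ top k → Decidable (InWindow top k)
inWindow? top k s = (top - + k ℤ.<? s) ×-dec (s ℤ.≤? top)

count-window : ∀ {A : Set} (v : A → ℤ) xs k top →
  count (inWindow? top k ∘ v) xs ≡ window (λ s → count (λ a → v a ℤ.≟ s) xs) k top
count-window v xs zero    top = count-∅ _ empty xs
  where
  empty : Empty (InWindow top 0 ∘ v)
  empty a (lo , hi) = ℤP.<-irrefl refl (ℤP.<-≤-trans (subst (ℤ._< v a) (ℤP.+-identityʳ top) lo) hi)
count-window v xs (suc k) top =
  trans (count-∪ _ _ _ disjoint split xs) (cong (count _ xs ℕ.+_) (count-window v xs k (top - + 1)))
  where
  top-1≡pred : top - + 1 ≡ ℤ.pred top
  top-1≡pred = ℤP.+-comm top (- + 1)
  lower : (top - + 1) - + k ≡ top - + suc k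
  lower = assoc top (+ k)
    where
    assoc : ∀ x k → (x - + 1) - k ≡ x - (+ 1 + k)
    assoc = solve-∀
  disjoint : Empty ((λ a → v a ≡ top) ∩ (InWindow (top - + 1) k ∘ v))
  disjoint a (refl , _ , hi) = ℤP.<-irrefl refl (ℤP.i≤pred[j]⇒i<j (subst (v a ℤ.≤_) top-1≡pred hi))
  split : InWindow top (suc k) ∘ v ≐ (λ a → v a ≡ top) ∪ (InWindow (top - + 1) k ∘ v)
  split = into , out
    where
    into : ∀ {a} → InWindow top (suc k) (v a) → v a ≡ top ⊎ InWindow (top - + 1) k (v a)
    into {a} (lo , hi) with v a ℤ.≟ top
    ... | yes va≡top = inj₁ va≡top
    ... | no  va≢top = inj₂ ( subst (ℤ._< v a) (sym lower) lo
                            , subst (v a ℤ.≤_) (sym top-1≡pred) (ℤP.i<j⇒i≤pred[j] (ℤP.≤∧≢⇒< hi va≢top)))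
    out : ∀ {a} → v a ≡ top ⊎ InWindow (top - + 1) k (v a) → InWindow top (suc k) (v a)
    out (inj₁ refl)      = subst (top - + suc k ℤ.<_) (ℤP.+-identityʳ top) (ℤP.+-monoʳ-< top ℤ.-<+) , ℤP.≤-refl
    out (inj₂ (lo , hi)) = subst (ℤ._< _) lower lo , ℤP.≤-trans hi (ℤP.i-j≤i top (+ 1))

digitSumCount : ℕ → ℕ → ℤ → ℕ
digitSumCount b n s = count (λ xs → sum xs ℤ.≟ s) (tuples b n)

digitSumCount-coeff : ∀ b n s → digitSumCount b n s ≡ coeff (polyPow (geomPoly b) n) (s + + (n ℕ.* half b))
digitSumCount-coeff b zero    (+ zero)  = refl
digitSumCount-coeff b zero    (+ suc _) = refl
digitSumCount-coeff b zero    -[1+ _ ]  = refl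
digitSumCount-coeff b (suc n) s = begin
  count P? (concatMap (λ d → map (d ∷_) (tuples b n)) (balancedDigits b))
    ≡⟨ count-concatMap P? (λ d → map (d ∷_) (tuples b n)) (balancedDigits b) ⟩
  sumℕ (map (λ d → count P? (map (d ∷_) (tuples b n))) (balancedDigits b))
    ≡⟨ cong sumℕ (LP.map-cong prepend (balancedDigits b)) ⟩
  sumℕ (map (λ d → digitSumCount b n (s - d)) (map (λ k → + k - + h) (upTo b)))
    ≡⟨ cong sumℕ (LP.map-∘ (upTo b)) ⟨
  sumℕ (map (λ k → digitSumCount b n (s - (+ k - + h))) (upTo b))
    ≡⟨ sumℕ-map-upTo (coeff Gⁿ) _ b (s + + (suc n ℕ.* h)) (λ k →
         trans (digitSumCount-coeff b n (s - (+ k - + h))) (cong (coeff Gⁿ) (regroup s (+ k) (+ h) (+ (n ℕ.* h))))) ⟩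
  window (coeff Gⁿ) b (s + + (suc n ℕ.* h))
    ≡⟨ coeff-geomPoly-⊛ b Gⁿ (s + + (suc n ℕ.* h)) ⟨
  coeff (polyPow (geomPoly b) (suc n)) (s + + (suc n ℕ.* h)) ∎
  where
  h = half b
  Gⁿ = polyPow (geomPoly b) n
  P? = λ (xs : List ℤ) → sum xs ℤ.≟ s
  prepend : ∀ d → count P? (map (d ∷_) (tuples b n)) ≡ digitSumCount b n (s - d)
  prepend d = trans (count-map P? (d ∷_) (tuples b n))
                    (count-≐ _ _ ( (λ d+S≡s → trans (sym (cancel d _)) (cong (λ y → y - d) d+S≡s))
                                 , (λ S≡s-d → trans (cong (λ y → d + y) S≡s-d) (restore d s)))
                             (tuples b n))
    where
    cancel : ∀ d S → (d + S) - d ≡ S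
    cancel = solve-∀
    restore : ∀ d s → d + (s - d) ≡ s
    restore = solve-∀
  regroup : ∀ s k h N → s - (k - h) + N ≡ (s + (h + N)) - k
  regroup = solve-∀

-- Carries

≤-translate : ∀ {a c a' c'} d → a ℤ.≤ c → a + d ≡ a' → c + d ≡ c' → a' ℤ.≤ c'
≤-translate d a≤c refl refl = ℤP.+-monoˡ-≤ d a≤c

¬2∣⇒≡half+half+1 : ∀ b → ¬ 2 ∣ b → b ≡ half b ℕ.+ half b ℕ.+ 1
¬2∣⇒≡half+half+1 zero    2∤b = contradiction (divides 0 refl) 2∤b
¬2∣⇒≡half+half+1 (suc c) 2∤b with c ℕ.% 2 | ℕD.m%n<n c 2 | ℕD.m≡m%n+[m/n]*n c 2
... | zero        | _ | c≡q*2 = trans (cong suc c≡q*2) (ring (c ℕ./ 2))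
  where
  ring : ∀ q → suc (0 ℕ.+ q ℕ.* 2) ≡ q ℕ.+ q ℕ.+ 1
  ring = ℕ-Solver.solve-∀
... | suc zero    | _ | c≡1+q*2 = contradiction (divides (suc (c ℕ./ 2)) (trans (cong suc c≡1+q*2) (ring (c ℕ./ 2)))) 2∤b
  where
  ring : ∀ q → suc (1 ℕ.+ q ℕ.* 2) ≡ suc q ℕ.* 2
  ring = ℕ-Solver.solve-∀
... | suc (suc _) | s≤s (s≤s ()) | _

carryOut≐window : ∀ b i j → b ≡ half b ℕ.+ half b ℕ.+ 1 →
  (λ xs → CarryOut b i xs j) ≐ (InWindow (j * + b + + half b - i) b ∘ sum)
carryOut≐window b i j b≡2h+1 = (λ {xs} → into {xs}) , (λ {xs} → out {xs})
  where
  h = half b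
  J = j * + b
  suc[top-b] : ℤ.suc ((J + + h - i) - + b) ≡ (J - + h) - i
  suc[top-b] = trans (cong (λ c → ℤ.suc ((J + + h - i) - + c)) b≡2h+1) (ring J (+ h) i)
    where
    ring : ∀ J h i → + 1 + ((J + h - i) - (h + h + + 1)) ≡ (J - h) - i
    ring = solve-∀
  into : ∀ {xs} → CarryOut b i xs j → InWindow (J + + h - i) b (sum xs)
  into {xs} (lo , hi) =
      ℤP.suc[i]≤j⇒i<j (≤-translate (- i) lo (sym suc[top-b]) (cancel i (sum xs)))
    , ≤-translate (- i) hi (cancel i (sum xs)) refl
    where
    cancel : ∀ i S → (i + S) - i ≡ S
    cancel = solve-∀
  out : ∀ {xs} → InWindow (J + + h - i) b (sum xs) → CarryOut b i xs j
  out {xs} (lo , hi) =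
      ≤-translate i (ℤP.i<j⇒suc[i]≤j lo) (trans (cong (_+ i) suc[top-b]) (restore (J - + h) i))
                  (ℤP.+-comm (sum xs) i)
    , ≤-translate i hi (ℤP.+-comm (sum xs) i) (restore (J + + h) i)
    where
    restore : ∀ a i → (a - i) + i ≡ a
    restore = solve-∀

carryCount-coeff : ∀ b n i j → ¬ 2 ∣ b →
  carryCount b n i j ≡ coeff (polyPow (geomPoly b) (suc n)) (expo b n i j)
carryCount-coeff b n i j 2∤b = begin
  carryCount b n i j
    ≡⟨ count-≐ _ _ (carryOut≐window b i j (¬2∣⇒≡half+half+1 b 2∤b)) (tuples b n) ⟩
  count (inWindow? top b ∘ sum) (tuples b n)
    ≡⟨ count-window sum (tuples b n) b top ⟩
  window (digitSumCount b n) b top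
    ≡⟨ window-shift (+ (n ℕ.* h)) (digitSumCount-coeff b n) b top ⟩
  window (coeff (polyPow (geomPoly b) n)) b (top + + (n ℕ.* h))
    ≡⟨ coeff-geomPoly-⊛ b _ _ ⟨
  coeff (polyPow (geomPoly b) (suc n)) (top + + (n ℕ.* h))
    ≡⟨ cong (coeff (polyPow (geomPoly b) (suc n))) (regroup (j * + b) (+ h) i (+ (n ℕ.* h))) ⟩
  coeff (polyPow (geomPoly b) (suc n)) (expo b n i j) ∎
  where
  h = half b
  top = j * + b + + h - i
  regroup : ∀ J h i N → J + h - i + N ≡ J + (h + N) - i
  regroup = solve-∀

theorem2p1 : (b n : ℕ) → 3 ≤ b → ¬ (2 ∣ b) → 2 ∣ n → 1 ≤ n →
    (i j : ℤ) →
    - (+ (n ℕ./ 2)) ℤ.≤ i → i ℤ.≤ + (n ℕ./ 2) →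
    - (+ (n ℕ./ 2)) ℤ.≤ j → j ℤ.≤ + (n ℕ./ 2) →
    (K b n i j ≡ (+ coeff (polyPow (geomPoly b) (suc n)) (expo b n i j)) over b ^ n)
      × (K b n i j ≡ alternatingSum b n i j over b ^ n)
theorem2p1 b@(suc c) n _ 2∤b _ _ i j _ _ _ _ =
    cong (λ m → (+ m) over b ^ n) count≡coeff
  , cong (λ z → z over b ^ n) (trans (cong +_ count≡coeff) (coeff-geomPoly^suc-alternating c n (expo b n i j)))
  where
  count≡coeff : carryCount b n i j ≡ coeff (polyPow (geomPoly b) (suc n)) (expo b n i j)
  count≡coeff = carryCount-coeff b n i j 2∤b
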